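{- Let $a,b$ be coprime positive integers and $d$ an integer with $1\le d<b-1$ and $d\mid(b-1)$. Suppose $(P,Q)\in NC_d(a,b)$ and $Q$ contains a central block $B$. Then exactly one of the following holds: $b-1\in B$, or $P$ contains a wrapping block.
   Context: An $a,b$-Dyck path is a lattice path from $(0,0)$ to $(b,a)$ with unit north steps $N$ and east steps $E$ staying above the line $y=\frac{a}{b}x$; write it as $D=N^{v_0}EN^{v_1}E\cdots N^{v_{b-1}}E$, $v_i\ge 0$. A vertical run of length $v$ is a $P$-rise if $v>a/b$ and a $Q$-rise if $v<a/b$. For $1\le i\le b-1$ the label $i$ is the point $(i,v_0+\dots+v_{i-1})$. If $v_i>0$, the laser $\ell(i)$ is the segment of slope $a/b$ from label $i$ going northeast until it next meets $D$ (in the interior of an east step). $\ell(D)$ is the set of pairs $(i,j)$ with $\ell(i)$ ending on the east step whose west endpoint has $x$-coordinate $j$. The labeled pair $\pi(D)=(P,Q)$ of set partitions of $[b-1]$: $i,j$ in the same block of $P$ iff labels $i,j$ are not separated by any laser (label $k$ lies strictly below $\ell(k)$), and a block $B\in P$ gets rank $v_{\min(B)-1}$; $Q$ is the equivalence relation generated by $i\sim j$ whenever $\ell(i),\ell(j)$ end on the same east step immediately following a $Q$-rise, or $(i,j)\in\ell(D)$, or $(j,i)\in\ell(D)$, and a block $B\in Q$ gets rank $v_{\max(B)}$. $NC(a,b)=\{\pi(D)\}$ over all $a,b$-Dyck paths; $P,Q$ are noncrossing. $\mathrm{rot}$ acts by $i\mapsto i+1$ ($b-1\mapsto1$) on all blocks,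 ranks kept. $NC_d(a,b)$ is the set of $(P,Q)\in NC(a,b)$ with $\mathrm{rot}^d(P,Q)=(P,Q)$. For a $\mathrm{rot}^d$-invariant noncrossing partition, a block $B$ is central if $\mathrm{rot}^d(B)=B$, and wrapping if it is not central and every block of its $\langle\mathrm{rot}^d\rangle$-orbit is contained in the interval $[\min B,\max B]$. -}

module Defs where

open import Data.Nat using (ℕ; zero; suc; _+_; _*_; _∸_; _≤_; _<_; _<ᵇ_)
open import Data.Bool using (if_then_else_)
open import Data.List using (List; []; _∷_; take)
open import Data.Nat.ListAction using (sum)
open import Data.Vec using (Vec; toList)
open import Data.Product using (Σ; _×_; ∃)
open import Data.Sum using (_⊎_)
open import Relation.Nullary using (¬_)
open import Relation.Binary.PropositionalEquality using (_≡_)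
open import Relation.Binary.Construct.Closure.Equivalence using (EqClosure)

nth : List ℕ → ℕ → ℕ
nth []       _       = 0
nth (x ∷ _)  zero    = x
nth (_ ∷ xs) (suc i) = nth xs i

ExactlyOne : Set → Set → Set
ExactlyOne A B = (A × ¬ B) ⊎ (¬ A × B)

module Rot (b : ℕ) where

  Label : ℕ → Set
  Label i = 1 ≤ i × i ≤ b ∸ 1

  rot : ℕ → ℕ
  rot i = if i <ᵇ (b ∸ 1) then suc i else 1

  rot^ : ℕ → ℕ → ℕ
  rot^ zero    i = i
  rot^ (suc k) i = rot (rot^ k i)

  -- notions for a partition of the labels, given as an equivalence
  -- relation R on ℕ relating labels only; the block of x is {y | R x y}.

  IsMinOf : (ℕ → ℕ → Set) → ℕ → ℕ → Set
  IsMinOf R x m = R x m × (∀ y → R x y → m ≤ y)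

  IsMaxOf : (ℕ → ℕ → Set) → ℕ → ℕ → Set
  IsMaxOf R x m = R x m × (∀ y → R x y → y ≤ m)

  RelInvariant : ℕ → (ℕ → ℕ → Set) → Set
  RelInvariant d R = ∀ x y → Label x → Label y →
    (R x y → R (rot^ d x) (rot^ d y)) × (R (rot^ d x) (rot^ d y) → R x y)

  Central : ℕ → (ℕ → ℕ → Set) → ℕ → Set
  Central d R x = ∀ y → Label y → (R x y → R x (rot^ d y)) × (R x (rot^ d y) → R x y)

  -- the block B of x is wrapping: not central, and every block rot^(kd)(B)
  -- of its orbit lies in the interval [min B, max B]
  Wrapping : ℕ → (ℕ → ℕ → Set) → ℕ → Set
  Wrapping d R x = Label x × ¬ Central d R x ×
    (∀ k y → R x y → Σ ℕ λ y₁ → Σ ℕ λ y₂ →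
       R x y₁ × R x y₂ × y₁ ≤ rot^ (k * d) y × rot^ (k * d) y ≤ y₂)

-- a,b-Dyck paths D = N^{v_0} E N^{v_1} E ⋯ N^{v_{b-1}} E, v : Vec ℕ b

module Path (a b : ℕ) (v : Vec ℕ b) where
  open Rot b public

  vat : ℕ → ℕ
  vat s = nth (toList v) s

  -- h i = v_0 + ⋯ + v_{i-1}: height of the path at the start of column x = i
  h : ℕ → ℕ
  h i = sum (take i (toList v))

  -- ends at (b,a) and stays (weakly) above y = (a/b) x
  IsDyck : Set
  IsDyck = h b ≡ a × (∀ i → i ≤ b → a * i ≤ b * h i)

  -- LaserEnd i j: label i has v_i > 0 and the laser ℓ(i) (slope a/b from
  -- (i, h i)) ends in the interior of the east step from (j, h(j+1)) to
  -- (j+1, h(j+1)), i.e. j ≥ i is the first column where the line rises above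
  -- the height of that east step.  Everything multiplied by b.
  LaserEnd : ℕ → ℕ → Set
  LaserEnd i j = Label i × 0 < vat i × i ≤ j × j < b ×
    b * h (suc j) < b * h i + a * (suc j ∸ i) ×
    (∀ m → i ≤ m → m < j → b * h i + a * (suc m ∸ i) ≤ b * h (suc m))

  -- label x lies above the laser ℓ(k) ending on east step j
  Inside : ℕ → ℕ → ℕ → Set
  Inside k j x = k < x × x ≤ j

  PRel : ℕ → ℕ → Set
  PRel x y = Label x × Label y ×
    (∀ k j → LaserEnd k j → (Inside k j x → Inside k j y) × (Inside k j y → Inside k j x))

  QGen : ℕ → ℕ → Set
  QGen i j = (Σ ℕ λ s → LaserEnd i s × LaserEnd j s × b * vat s < a)
           ⊎ LaserEnd i j ⊎ LaserEnd j i

  QRel : ℕ → ℕ → Set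
  QRel x y = Label x × Label y × EqClosure QGen x y

  -- rot^d (P,Q) = (P,Q) as labeled pairs: same blocks, and each block is sent
  -- to a block of the same rank (P-rank v_{min B - 1}, Q-rank v_{max B}).
  RotInvariant : ℕ → Set
  RotInvariant d =
    RelInvariant d PRel ×
    (∀ x m m′ → Label x → IsMinOf PRel x m → IsMinOf PRel (rot^ d x) m′ →
       vat (m ∸ 1) ≡ vat (m′ ∸ 1)) ×
    RelInvariant d QRel ×
    (∀ x m m′ → Label x → IsMaxOf QRel x m → IsMaxOf QRel (rot^ d x) m′ →
       vat m ≡ vat m′)

-- A laser ℓ(k) ending on column j splits no block of P: each block lies inside or outside (k, j].
-- Encoding the window (u, w] by [u < x] xor [w < x], "P respects the window" is an equivalence
-- relation in (u, w) containing the generators of Q, so it holds whenever u, w share a Q-block.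
--
-- If b−1 lies in the central block B, so does c = b−1−d, hence no P-block straddles c: rot^d
-- translates a block below c upwards by d forever, and throws a block above c below c (as
-- 2d ≤ b−1), so neither wraps.  Otherwise let m = min B and M = max B < b−1.  Lasers do not
-- cross, so a Q-block meeting the inside of a laser stays inside or reaches its end; hence no
-- laser separates m from M+1.  Each rot^{kd}(m) lies in B, and the window (m, rot^{kd}(m)]
-- confines the rotated P-block of m to [m, M]: the block of m wraps.  It is not central, since
-- the window (m, rot^d(m)] separates m from rot^d(m).

module Submission where

open import Defs
open import Data.Nat using (ℕ; zero; suc; _+_; _*_; _∸_; _≤_; _<_; _<ᵇ_; z≤n; s≤s; s≤s⁻¹; _≤?_; _<?_; _≟_)
open import Data.Nat.Properties
open import Data.Nat.Divisibility using (_∣_; divides)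
open import Data.Nat.Coprimality using (Coprime)
open import Data.Nat.GeneralisedArithmetic using (iterate)
open import Data.Bool using (Bool; true; false; T; _xor_)
open import Data.Bool.Properties using (xor-assoc; xor-comm; xor-same)
open import Data.Unit using (tt)
open import Data.Vec using (Vec)
open import Data.Product using (Σ; ∃; _×_; _,_; proj₁; proj₂; swap)
open import Data.Sum using (_⊎_; inj₁; inj₂)
open import Function using (_∘_; case_of_)
open import Level using (0ℓ)
open import Relation.Nullary using (¬_; Dec; yes; no; does; contradiction)
open import Relation.Nullary.Decidable using (dec-true; dec-false; _×-dec_)
open import Relation.Unary using (Pred; Decidable)
open import Relation.Binary using (Rel; IsEquivalence; tri<; tri≈; tri>)
open import Relation.Binary.PropositionalEquality
  using (_≡_; _≢_; refl; sym; trans; cong; cong₂; subst; subst₂; isEquivalence; module ≡-Reasoning)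
open import Relation.Binary.Construct.Closure.Equivalence using (EqClosure)
import Relation.Binary.Construct.Closure.Equivalence as EqClosure
open import Relation.Binary.Construct.Closure.ReflexiveTransitive using (ε; _◅_; _◅◅_)
open import Relation.Binary.Construct.Closure.Symmetric using (SymClosure; fwd; bwd)

module _ {P : Pred ℕ 0ℓ} (P? : Decidable P) where

  least-below : ∀ n → (∃ λ m → m < n × P m × (∀ {k} → k < m → ¬ P k))
                    ⊎ (∀ {k} → k < n → ¬ P k)
  least-below zero = inj₂ λ ()
  least-below (suc n) with least-below n
  ... | inj₁ (m , m<n , pm , below) = inj₁ (m , m<n⇒m<1+n m<n , pm , below)
  ... | inj₂ none with P? n
  ...   | yes pn = inj₁ (n , n<1+n n , pn , none)
  ...   | no ¬pn = inj₂ λ k<1+n → case m<1+n⇒m<n∨m≡n k<1+n of λ where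
            (inj₁ k<n) → none k<n
            (inj₂ refl) → ¬pn

  least-witness : ∀ {n} → P n → ∃ λ m → P m × (∀ {k} → P k → m ≤ k)
  least-witness {n} pn with least-below (suc n)
  ... | inj₁ (m , _ , pm , below) = m , pm , λ pk → ≮⇒≥ λ k<m → below k<m pk
  ... | inj₂ none = contradiction pn (none (n<1+n n))

iterate-suc : ∀ (f : ℕ → ℕ) k i → iterate f i (suc k) ≡ f (iterate f i k)
iterate-suc f zero i = refl
iterate-suc f (suc k) i = iterate-suc f k (f i)

iterate-fixed : ∀ {f : ℕ → ℕ} k {i} → f i ≡ i → iterate f i k ≡ i
iterate-fixed zero _ = refl
iterate-fixed {f} (suc k) {i} fi≡i = trans (cong (λ j → iterate f j k) fi≡i) (iterate-fixed k fi≡i)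

module _ {f : ℕ → ℕ} {n : ℕ} (inflationary : ∀ i → i ≤ f i) (bounded : ∀ {i} → i ≤ n → f i ≤ n) where

  ≤-iterate : ∀ k i → i ≤ iterate f i k
  ≤-iterate zero i = ≤-refl
  ≤-iterate (suc k) i = ≤-trans (inflationary i) (≤-iterate k (f i))

  iterate-≤ : ∀ k {i} → i ≤ n → iterate f i k ≤ n
  iterate-≤ zero i≤n = i≤n
  iterate-≤ (suc k) i≤n = iterate-≤ k (bounded i≤n)

  iterate-stabilises : ∀ k {i} → i ≤ n → f (iterate f i k) ≡ iterate f i k ⊎ i + k ≤ iterate f i k
  iterate-stabilises zero {i} _ = inj₂ (≤-reflexive (+-identityʳ i))
  iterate-stabilises (suc k) {i} i≤n with m≤n⇒m<n∨m≡n (inflationary i)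
  ... | inj₂ i≡fi = inj₁ (trans (cong f orbit≡i) (trans (sym i≡fi) (sym orbit≡i)))
    where
    orbit≡i : iterate f (f i) k ≡ i
    orbit≡i = iterate-fixed (suc k) (sym i≡fi)
  ... | inj₁ i<fi with iterate-stabilises k (bounded i≤n)
  ...   | inj₁ fixed = inj₁ fixed
  ...   | inj₂ fi+k≤ = inj₂ (subst (_≤ iterate f (f i) k) (sym (+-suc i k)) (≤-trans (+-monoˡ-≤ k i<fi) fi+k≤))

  iterate-fixedPoint : ∀ {i} → i ≤ n → f (iterate f i (suc n)) ≡ iterate f i (suc n)
  iterate-fixedPoint {i} i≤n with iterate-stabilises (suc n) i≤n
  ... | inj₁ fixed = fixed
  ... | inj₂ i+1+n≤ = contradiction (m≤n+m n i)
        (<⇒≱ (subst (_≤ n) (+-suc i n) (≤-trans i+1+n≤ (iterate-≤ (suc n) i≤n))))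

above : ℕ → ℕ → Bool
above c x = does (c <? x)

window : ℕ → ℕ → ℕ → Bool
window u w x = above u x xor above w x

record Respects (R : Rel ℕ 0ℓ) (u w : ℕ) : Set where
  constructor respects
  field window-≡ : ∀ {x y} → R x y → window u w x ≡ window u w y
open Respects

window-inside : ∀ {u w x} → u < x → x ≤ w → window u w x ≡ true
window-inside {u} {w} {x} u<x x≤w =
  cong₂ _xor_ (dec-true (u <? x) u<x) (dec-false (w <? x) (≤⇒≯ x≤w))

window-outside : ∀ {u w x} → u ≤ w → ¬ (u < x × x ≤ w) → window u w x ≡ false
window-outside {u} {w} {x} u≤w outside with x ≤? u | w <? x
... | yes x≤u | _ =
  cong₂ _xor_ (dec-false (u <? x) (≤⇒≯ x≤u)) (dec-false (w <? x) (≤⇒≯ (≤-trans x≤u u≤w)))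
... | no x≰u | yes w<x = cong₂ _xor_ (dec-true (u <? x) (≰⇒> x≰u)) (dec-true (w <? x) w<x)
... | no x≰u | no w≮x = contradiction (≰⇒> x≰u , ≮⇒≥ w≮x) outside

window-trans : ∀ u w t x → window u t x ≡ window u w x xor window w t x
window-trans u w t x = sym (begin
    (p xor q) xor (q xor r)  ≡⟨ xor-assoc p q (q xor r) ⟩
    p xor (q xor (q xor r))  ≡⟨ cong (p xor_) (sym (xor-assoc q q r)) ⟩
    p xor ((q xor q) xor r)  ≡⟨ cong (λ e → p xor (e xor r)) (xor-same q) ⟩
    p xor r                  ∎)
  where
  open ≡-Reasoning
  p = above u x
  q = above w x
  r = above t x

module _ {R : Rel ℕ 0ℓ} where

  Respects-refl : ∀ {u} → Respects R u u
  Respects-refl {u} = respects λ {x} {y} _ → trans (xor-same (above u x)) (sym (xor-same (above u y)))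

  Respects-sym : ∀ {u w} → Respects R u w → Respects R w u
  Respects-sym {u} {w} resp = respects λ {x} {y} xRy →
    trans (xor-comm (above w x) (above u x)) (trans (window-≡ resp xRy) (xor-comm (above u y) (above w y)))

  Respects-trans : ∀ {u w t} → Respects R u w → Respects R w t → Respects R u t
  Respects-trans {u} {w} {t} resp₁ resp₂ = respects λ {x} {y} xRy → begin
    window u t x                        ≡⟨ window-trans u w t x ⟩
    window u w x xor window w t x       ≡⟨ cong₂ _xor_ (window-≡ resp₁ xRy) (window-≡ resp₂ xRy) ⟩
    window u w y xor window w t y       ≡⟨ sym (window-trans u w t y) ⟩
    window u t y                        ∎
    where open ≡-Reasoning

  Respects-isEquivalence : IsEquivalence (Respects R)
  Respects-isEquivalence = record { refl = Respects-refl ; sym = Respects-sym ; trans = Respects-trans }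

  Respects-inside : ∀ {u w x y} → u ≤ w → Respects R u w → R x y → u < x × x ≤ w → u < y × y ≤ w
  Respects-inside {u} {w} {y = y} u≤w resp xRy (u<x , x≤w) with u <? y ×-dec y ≤? w
  ... | yes inside = inside
  ... | no outside = contradiction
        (trans (sym (window-inside u<x x≤w)) (trans (window-≡ resp xRy) (window-outside u≤w outside))) λ ()

∸-split : ∀ {k i m} → k ≤ i → i ≤ m → m ∸ k ≡ (i ∸ k) + (m ∸ i)
∸-split {zero} z≤n i≤m = sym (m+[n∸m]≡n i≤m)
∸-split {suc k} (s≤s k≤i) (s≤s i≤m) = ∸-split k≤i i≤m

proper-divisor-+-≤ : ∀ {d n} → d ∣ n → d < n → d + d ≤ n
proper-divisor-+-≤ (divides zero refl) ()
proper-divisor-+-≤ {d} (divides (suc zero) refl) d<d+0 =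
  contradiction d<d+0 (≤⇒≯ (≤-reflexive (+-identityʳ d)))
proper-divisor-+-≤ {d} (divides (suc (suc q)) refl) _ = +-monoʳ-≤ d (m≤m+n d (q * d))

module Rotation (b : ℕ) where
  open Rot b

  N : ℕ
  N = b ∸ 1

  rot-< : ∀ {x} → x < N → rot x ≡ suc x
  rot-< {x} x<N with x <ᵇ N | <⇒<ᵇ x<N
  ... | true | _ = refl

  rot-≥ : ∀ {x} → N ≤ x → rot x ≡ 1
  rot-≥ {x} N≤x with x <ᵇ N in eq
  ... | false = refl
  ... | true = contradiction (<ᵇ⇒< x N (subst T (sym eq) tt)) (≤⇒≯ N≤x)

  rot^-+ : ∀ m k x → rot^ (m + k) x ≡ rot^ m (rot^ k x)
  rot^-+ zero k x = refl
  rot^-+ (suc m) k x = cong rot (rot^-+ m k x)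

  rot^-no-wrap : ∀ j x → x + j ≤ N → rot^ j x ≡ x + j
  rot^-no-wrap zero x _ = sym (+-identityʳ x)
  rot^-no-wrap (suc j) x x+1+j≤N = begin
    rot (rot^ j x)  ≡⟨ cong rot (rot^-no-wrap j x (≤-trans (n≤1+n _) 1+x+j≤N)) ⟩
    rot (x + j)     ≡⟨ rot-< 1+x+j≤N ⟩
    suc (x + j)     ≡⟨ sym (+-suc x j) ⟩
    x + suc j       ∎
    where
    open ≡-Reasoning
    1+x+j≤N : suc (x + j) ≤ N
    1+x+j≤N = subst (_≤ N) (+-suc x j) x+1+j≤N

  rot^-from-N : ∀ r → suc r ≤ N → rot^ (suc r) N ≡ suc r
  rot^-from-N r 1+r≤N = begin
    rot^ (suc r) N    ≡⟨ cong (λ e → rot^ e N) (+-comm 1 r) ⟩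
    rot^ (r + 1) N    ≡⟨ rot^-+ r 1 N ⟩
    rot^ r (rot N)    ≡⟨ cong (rot^ r) (rot-≥ ≤-refl) ⟩
    rot^ r 1          ≡⟨ rot^-no-wrap r 1 1+r≤N ⟩
    suc r             ∎
    where open ≡-Reasoning

  wrap-split : ∀ {x j} → x ≤ N → N < x + j → ∃ λ r → j ≡ (N ∸ x) + suc r
  wrap-split {x} {j} x≤N N<x+j = j ∸ suc (N ∸ x) , sym (trans (+-suc (N ∸ x) _) (m+[n∸m]≡n N∸x<j))
    where
    N∸x<j : N ∸ x < j
    N∸x<j = +-cancelˡ-< x (N ∸ x) j (subst (_< x + j) (sym (m+[n∸m]≡n x≤N)) N<x+j)

  rot^-wrap : ∀ {x} r → x ≤ N → suc r ≤ N → rot^ ((N ∸ x) + suc r) x ≡ suc r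
  rot^-wrap {x} r x≤N 1+r≤N = begin
    rot^ ((N ∸ x) + suc r) x        ≡⟨ cong (λ e → rot^ e x) (+-comm (N ∸ x) (suc r)) ⟩
    rot^ (suc r + (N ∸ x)) x        ≡⟨ rot^-+ (suc r) (N ∸ x) x ⟩
    rot^ (suc r) (rot^ (N ∸ x) x)   ≡⟨ cong (rot^ (suc r)) (trans (rot^-no-wrap (N ∸ x) x (≤-reflexive x+[N∸x]≡N)) x+[N∸x]≡N) ⟩
    rot^ (suc r) N                  ≡⟨ rot^-from-N r 1+r≤N ⟩
    suc r                           ∎
    where
    open ≡-Reasoning
    x+[N∸x]≡N : x + (N ∸ x) ≡ N
    x+[N∸x]≡N = m+[n∸m]≡n x≤N

  rot^-moves : ∀ {d x} → 0 < d → d < N → Label x → rot^ d x ≢ x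
  rot^-moves {d} {x} 0<d d<N (_ , x≤N) rot^dx≡x with x + d ≤? N
  ... | yes x+d≤N = <-irrefl (trans (sym rot^dx≡x) (rot^-no-wrap d x x+d≤N)) (subst (_< x + d) (+-identityʳ x) (+-monoʳ-< x 0<d))
  ... | no x+d≰N with wrap-split {x} {d} x≤N (≰⇒> x+d≰N)
  ...   | r , refl = <-irrefl d≡N d<N
    where
    d≡N : (N ∸ x) + suc r ≡ N
    d≡N = trans (cong ((N ∸ x) +_) (trans (sym (rot^-wrap r x≤N (≤-trans (m≤n+m _ _) (<⇒≤ d<N)))) rot^dx≡x)) (m∸n+n≡m x≤N)

  rot^-wrap-≤ : ∀ {x j} → x ≤ N → N < x + j → j ≤ N → rot^ j x ≤ j
  rot^-wrap-≤ {x} x≤N N<x+j j≤N with wrap-split x≤N N<x+j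
  ... | r , refl = ≤-trans (≤-reflexive (rot^-wrap r x≤N (≤-trans (m≤n+m _ _) j≤N))) (m≤n+m (suc r) (N ∸ x))

  module _ {R : Rel ℕ 0ℓ} (labels : ∀ {y z} → R y z → Label y × Label z) (d : ℕ) where

    RelInvariant-rot^* : RelInvariant d R → ∀ k {y z} → R y z → R (rot^ (k * d) y) (rot^ (k * d) z)
    RelInvariant-rot^* inv zero yRz = yRz
    RelInvariant-rot^* inv (suc k) {y} {z} yRz =
      subst₂ R (sym (rot^-+ d (k * d) y)) (sym (rot^-+ d (k * d) z))
        (proj₁ (inv _ _ (proj₁ (labels q)) (proj₂ (labels q))) q)
      where q = RelInvariant-rot^* inv k yRz

    Central-rot^* : ∀ {x} → Central d R x → ∀ k {y} → R x y → R x (rot^ (k * d) y)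
    Central-rot^* cen zero xRy = xRy
    Central-rot^* {x} cen (suc k) {y} xRy =
      subst (R x) (sym (rot^-+ d (k * d) y)) (proj₁ (cen _ (proj₂ (labels q))) q)
      where q = Central-rot^* cen k xRy

module Lasers (a b : ℕ) (v : Vec ℕ b) where
  open Path a b v
  open Rotation b using (N)

  QEq : Rel ℕ 0ℓ
  QEq = EqClosure QGen

  laser-QEq : ∀ {i j} → LaserEnd i j → QEq i j
  laser-QEq ℓ = EqClosure.return (inj₂ (inj₁ ℓ))

  laserEnd-Label : ∀ {i j} → LaserEnd i j → Label j
  laserEnd-Label ((1≤i , _) , _ , i≤j , j<b , _) = ≤-trans 1≤i i≤j , <⇒≤pred j<b

  laserEnd-unique : ∀ {i j j′} → LaserEnd i j → LaserEnd i j′ → j ≡ j′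
  laserEnd-unique {j = j} {j′} (_ , _ , i≤j , _ , exceeds , below) (_ , _ , i≤j′ , _ , exceeds′ , below′)
    with <-cmp j j′
  ... | tri≈ _ j≡j′ _ = j≡j′
  ... | tri< j<j′ _ _ = contradiction (below′ j i≤j j<j′) (<⇒≱ exceeds)
  ... | tri> _ _ j′<j = contradiction (below j′ i≤j′ j′<j) (<⇒≱ exceeds′)

  -- ℓ(k) passes below label i and is parallel to ℓ(i): while ℓ(i) stays under the path, so does ℓ(k).
  laser-nested : ∀ {k j i j′} → LaserEnd k j → LaserEnd i j′ → k < i → i < j → j′ ≤ j
  laser-nested {k} {j} {suc i} {j′} (_ , _ , _ , _ , exceeds , belowₖ) (_ , _ , _ , _ , _ , belowᵢ) (s≤s k≤i) i<j =
    ≮⇒≥ λ j<j′ → <⇒≱ exceeds (begin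
      b * h k + a * (suc j ∸ k)                         ≡⟨ cong (b * h k +_) split ⟩
      b * h k + (a * (suc i ∸ k) + a * (suc j ∸ suc i)) ≡⟨ sym (+-assoc (b * h k) _ _) ⟩
      b * h k + a * (suc i ∸ k) + a * (suc j ∸ suc i)   ≤⟨ +-monoˡ-≤ _ (belowₖ i k≤i (<-trans (n<1+n i) i<j)) ⟩
      b * h (suc i) + a * (suc j ∸ suc i)               ≤⟨ belowᵢ j (<⇒≤ i<j) j<j′ ⟩
      b * h (suc j)                                     ∎)
    where
    open ≤-Reasoning
    split : a * (suc j ∸ k) ≡ a * (suc i ∸ k) + a * (suc j ∸ suc i)
    split = trans (cong (a *_) (∸-split (≤-trans k≤i (n≤1+n i)) (≤-trans (<⇒≤ i<j) (n≤1+n j))))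
                  (*-distribˡ-+ a _ _)

  module _ {k j} (ℓk : LaserEnd k j) where

    laser-from-inside : ∀ {w s} → k < w → w < j → LaserEnd w s → (k < s × s < j) ⊎ QEq w j
    laser-from-inside k<w w<j ℓw@(_ , _ , w≤s , _) with m≤n⇒m<n∨m≡n (laser-nested ℓk ℓw k<w w<j)
    ... | inj₁ s<j = inj₁ (<-≤-trans k<w w≤s , s<j)
    ... | inj₂ refl = inj₂ (laser-QEq ℓw)

    laser-into-inside : ∀ {w w′} → k < w → w < j → LaserEnd w′ w → k < w′ × w′ < j
    laser-into-inside {w} {w′} k<w w<j ℓw′@(_ , _ , w′≤w , _) with <-cmp w′ k
    ... | tri< w′<k _ _ = contradiction (laser-nested ℓw′ ℓk w′<k k<w) (<⇒≱ w<j)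
    ... | tri≈ _ refl _ = contradiction (laserEnd-unique ℓk ℓw′) (<⇒≢ w<j ∘ sym)
    ... | tri> _ _ k<w′ = k<w′ , ≤-<-trans w′≤w w<j

    common-end : ∀ {w w′ s} → k < w → w < j → LaserEnd w s → LaserEnd w′ s → (k < w′ × w′ < j) ⊎ QEq w j
    common-end k<w w<j ℓw ℓw′ with laser-from-inside k<w w<j ℓw
    ... | inj₁ (k<s , s<j) = inj₁ (laser-into-inside k<s s<j ℓw′)
    ... | inj₂ w~j = inj₂ w~j

    QGen-from-inside : ∀ {w w′} → k < w → w < j → SymClosure QGen w w′ → (k < w′ × w′ < j) ⊎ QEq w j
    QGen-from-inside k<w w<j (fwd (inj₁ (_ , ℓw , ℓw′ , _))) = common-end k<w w<j ℓw ℓw′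
    QGen-from-inside k<w w<j (bwd (inj₁ (_ , ℓw′ , ℓw , _))) = common-end k<w w<j ℓw ℓw′
    QGen-from-inside k<w w<j (fwd (inj₂ (inj₁ ℓw)))          = laser-from-inside k<w w<j ℓw
    QGen-from-inside k<w w<j (bwd (inj₂ (inj₂ ℓw)))          = laser-from-inside k<w w<j ℓw
    QGen-from-inside k<w w<j (fwd (inj₂ (inj₂ ℓw′)))         = inj₁ (laser-into-inside k<w w<j ℓw′)
    QGen-from-inside k<w w<j (bwd (inj₂ (inj₁ ℓw′)))         = inj₁ (laser-into-inside k<w w<j ℓw′)

    QEq-escape : ∀ {u w} → k < u → u < j → QEq u w → (k < w × w < j) ⊎ QEq u j
    QEq-escape k<u u<j ε = inj₁ (k<u , u<j)
    QEq-escape k<u u<j (g ◅ u′~w) with QGen-from-inside k<u u<j g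
    ... | inj₂ u~j = inj₂ u~j
    ... | inj₁ (k<u′ , u′<j) with QEq-escape k<u′ u′<j u′~w
    ...   | inj₁ inside = inj₁ inside
    ...   | inj₂ u′~j = inj₂ (g ◅ u′~j)

  PRel-refl : ∀ {x} → Label x → PRel x x
  PRel-refl lx = lx , lx , λ _ _ _ → (λ inside → inside) , (λ inside → inside)

  PRel-sym : ∀ {x y} → PRel x y → PRel y x
  PRel-sym (lx , ly , sameSide) = ly , lx , λ k j ℓ → swap (sameSide k j ℓ)

  laser-Respects : ∀ {k j} → LaserEnd k j → Respects PRel k j
  laser-Respects {k} {j} ℓ@(_ , _ , k≤j , _) = respects same-window
    where
    same-window : ∀ {x y} → PRel x y → window k j x ≡ window k j y
    same-window {x} (_ , _ , sameSide) with k <? x ×-dec x ≤? j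
    ... | no outside =
      trans (window-outside k≤j outside) (sym (window-outside k≤j (outside ∘ proj₂ (sameSide k j ℓ))))
    ... | yes (k<x , x≤j) with proj₁ (sameSide k j ℓ) (k<x , x≤j)
    ...   | k<y , y≤j = trans (window-inside k<x x≤j) (sym (window-inside k<y y≤j))

  QGen⇒Respects : ∀ {i j} → QGen i j → Respects PRel i j
  QGen⇒Respects (inj₁ (_ , ℓi , ℓj , _)) = Respects-trans (laser-Respects ℓi) (Respects-sym (laser-Respects ℓj))
  QGen⇒Respects (inj₂ (inj₁ ℓ))          = laser-Respects ℓ
  QGen⇒Respects (inj₂ (inj₂ ℓ))          = Respects-sym (laser-Respects ℓ)

  QEq⇒Respects : ∀ {u w} → QEq u w → Respects PRel u w
  QEq⇒Respects = EqClosure.fold Respects-isEquivalence QGen⇒Respects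

  opaque
    laserEnd? : ∀ i → Dec (∃ (LaserEnd i))
    laserEnd? i with (1 ≤? i ×-dec i ≤? N) ×-dec 0 <? vat i
                   | least-below (λ j → i ≤? j ×-dec b * h (suc j) <? b * h i + a * (suc j ∸ i)) b
    ... | no ¬start | _ = no λ (_ , li , vi , _) → ¬start (li , vi)
    ... | yes _ | inj₂ none = no λ (_ , _ , _ , i≤j , j<b , exceeds , _) → none j<b (i≤j , exceeds)
    ... | yes (li , vi) | inj₁ (j , j<b , (i≤j , exceeds) , below) =
      yes (j , li , vi , i≤j , j<b , exceeds , λ m i≤m m<j → ≮⇒≥ λ m-exceeds → below m<j (i≤m , m-exceeds))

  -- Iterating next reaches the maximum of the Q-block, which therefore decides Q.
  next : ℕ → ℕ
  next i with laserEnd? i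
  ... | yes (j , _) = j
  ... | no _ = i

  next-LaserEnd : ∀ {i j} → LaserEnd i j → next i ≡ j
  next-LaserEnd {i} ℓ with laserEnd? i
  ... | yes (_ , ℓ′) = laserEnd-unique ℓ′ ℓ
  ... | no none = contradiction (_ , ℓ) none

  ≤-next : ∀ i → i ≤ next i
  ≤-next i with laserEnd? i
  ... | yes (_ , _ , _ , i≤j , _) = i≤j
  ... | no _ = ≤-refl

  next-≤ : ∀ {i} → i ≤ N → next i ≤ N
  next-≤ {i} i≤N with laserEnd? i
  ... | yes (_ , _ , _ , _ , j<b , _) = <⇒≤pred j<b
  ... | no _ = i≤N

  next-QEq : ∀ i → QEq i (next i)
  next-QEq i with laserEnd? i
  ... | yes (_ , ℓ) = laser-QEq ℓ
  ... | no _ = ε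

  root : ℕ → ℕ
  root i = iterate next i (suc N)

  ≤-root : ∀ i → i ≤ root i
  ≤-root = ≤-iterate ≤-next next-≤ (suc N)

  root-Label : ∀ {i} → Label i → Label (root i)
  root-Label {i} (1≤i , i≤N) = ≤-trans 1≤i (≤-root i) , iterate-≤ ≤-next next-≤ (suc N) i≤N

  root-next : ∀ {i} → i ≤ N → root (next i) ≡ root i
  root-next {i} i≤N = trans (iterate-suc next (suc N) i) (iterate-fixedPoint ≤-next next-≤ i≤N)

  iterate-next-QEq : ∀ k i → QEq i (iterate next i k)
  iterate-next-QEq zero i = ε
  iterate-next-QEq (suc k) i = next-QEq i ◅◅ iterate-next-QEq k (next i)

  laser-root : ∀ {i j} → LaserEnd i j → root i ≡ root j
  laser-root ℓ@((_ , i≤N) , _) = trans (sym (root-next i≤N)) (cong root (next-LaserEnd ℓ))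

  QGen⇒root≡ : ∀ {i j} → QGen i j → root i ≡ root j
  QGen⇒root≡ (inj₁ (_ , ℓi , ℓj , _)) = trans (laser-root ℓi) (sym (laser-root ℓj))
  QGen⇒root≡ (inj₂ (inj₁ ℓ))          = laser-root ℓ
  QGen⇒root≡ (inj₂ (inj₂ ℓ))          = sym (laser-root ℓ)

  QEq⇒root≡ : ∀ {u w} → QEq u w → root u ≡ root w
  QEq⇒root≡ = EqClosure.gfold isEquivalence root QGen⇒root≡

  root≡⇒QRel : ∀ {u w} → Label u → Label w → root u ≡ root w → QRel u w
  root≡⇒QRel {u} {w} lu lw same = lu , lw ,
    (iterate-next-QEq (suc N) u ◅◅ subst (λ r → QEq r w) (sym same) (EqClosure.symmetric QGen (iterate-next-QEq (suc N) w)))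

  QRel? : ∀ {u w} → Label u → Label w → Dec (QRel u w)
  QRel? {u} {w} lu lw with root u ≟ root w
  ... | yes same = yes (root≡⇒QRel lu lw same)
  ... | no differ = no λ (_ , _ , u~w) → differ (QEq⇒root≡ u~w)

  QRel-≤-root : ∀ {u w} → QRel u w → w ≤ root u
  QRel-≤-root {w = w} (_ , _ , u~w) = ≤-trans (≤-root w) (≤-reflexive (sym (QEq⇒root≡ u~w)))

module Main (a b : ℕ) (v : Vec ℕ b) where
  open Path a b v
  open Rotation b
  open Lasers a b v

  PRel-labels : ∀ {y z} → PRel y z → Label y × Label z
  PRel-labels (ly , lz , _) = ly , lz

  QRel-labels : ∀ {y z} → QRel y z → Label y × Label z
  QRel-labels (ly , lz , _) = ly , lz

  module _ {d} (1≤d : 1 ≤ d) (d<N : d < N) (d∣N : d ∣ N) (P-invariant : RelInvariant d PRel)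
           {x} (lx : Label x) (B-central : Central d QRel x) where

    B-rot : ∀ k {y} → QRel x y → QRel x (rot^ (k * d) y)
    B-rot = Central-rot^* QRel-labels d B-central

    P-rot : ∀ k {y z} → PRel y z → PRel (rot^ (k * d) y) (rot^ (k * d) z)
    P-rot = RelInvariant-rot^* PRel-labels d P-invariant

    B-Respects : ∀ {u w} → QRel x u → QRel x w → Respects PRel u w
    B-Respects (_ , _ , x~u) (_ , _ , x~w) = QEq⇒Respects (EqClosure.symmetric QGen x~u ◅◅ x~w)

    lN : Label N
    lN = ≤-trans 1≤d (<⇒≤ d<N) , ≤-refl

    module LastLabelInBlock (x~N : QRel x N) where

      c : ℕ
      c = N ∸ d

      c+d≡N : c + d ≡ N
      c+d≡N = m∸n+n≡m (<⇒≤ d<N)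

      c<N : c < N
      c<N = subst (c <_) c+d≡N (m<m+n c 1≤d)

      d≤c : d ≤ c
      d≤c = +-cancelʳ-≤ d d c (subst (d + d ≤_) (sym c+d≡N) (proper-divisor-+-≤ d∣N d<N))

      x~c : QRel x c
      x~c = proj₂ (B-central c (m<n⇒0<n∸m d<N , m∸n≤m N d)) (subst (QRel x) (sym rot^dc≡N) x~N)
        where
        rot^dc≡N : rot^ d c ≡ N
        rot^dc≡N = trans (rot^-no-wrap d c (≤-reflexive c+d≡N)) c+d≡N

      P-above-c : ∀ {y w} → PRel y w → c < y → c < w
      P-above-c y~w@((_ , y≤N) , _) c<y =
        proj₁ (Respects-inside (<⇒≤ c<N) (B-Respects x~c x~N) y~w (c<y , y≤N))

      not-wrapping-below-c : ∀ {y} → Wrapping d PRel y → ¬ y ≤ c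
      not-wrapping-below-c {y} (ly , _ , wraps) y≤c = <-irrefl refl (begin-strict
        N                ≤⟨ subst (_≤ N * d) (*-identityʳ N) (*-monoʳ-≤ N 1≤d) ⟩
        N * d            ≤⟨ m≤n+m (N * d) y ⟩
        y + N * d        ≡⟨ orbit N ⟨
        rot^ (N * d) y   ≤⟨ orbit-≤c N ⟩
        c                <⟨ c<N ⟩
        N                ∎)
        where
        open ≤-Reasoning
        orbit-≤c : ∀ k → rot^ (k * d) y ≤ c
        orbit-≤c k with wraps k y (PRel-refl ly)
        ... | _ , _ , _ , y~y₂ , _ , ≤y₂ =
          ≤-trans ≤y₂ (≮⇒≥ λ c<y₂ → <⇒≱ (P-above-c (PRel-sym y~y₂) c<y₂) y≤c)
        orbit : ∀ k → rot^ (k * d) y ≡ y + k * d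
        orbit zero = sym (+-identityʳ y)
        orbit (suc k) = begin-equality
          rot^ (d + k * d) y      ≡⟨ rot^-+ d (k * d) y ⟩
          rot^ d (rot^ (k * d) y) ≡⟨ cong (rot^ d) (orbit k) ⟩
          rot^ d (y + k * d)      ≡⟨ rot^-no-wrap d (y + k * d) no-wrap ⟩
          y + k * d + d           ≡⟨ +-assoc y (k * d) d ⟩
          y + (k * d + d)         ≡⟨ cong (y +_) (+-comm (k * d) d) ⟩
          y + (d + k * d)         ∎
          where
          no-wrap : y + k * d + d ≤ N
          no-wrap = subst (y + k * d + d ≤_) c+d≡N (+-monoˡ-≤ d (subst (_≤ c) (orbit k) (orbit-≤c k)))

      not-wrapping-above-c : ∀ {y} → Wrapping d PRel y → ¬ c < y
      not-wrapping-above-c {y} (ly@(_ , y≤N) , _ , wraps) c<y with wraps 1 y (PRel-refl ly)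
      ... | y₁ , _ , y~y₁ , _ , y₁≤ , _ = <⇒≱ (P-above-c y~y₁ c<y) (begin
        y₁              ≤⟨ y₁≤ ⟩
        rot^ (1 * d) y  ≡⟨ cong (λ e → rot^ e y) (*-identityˡ d) ⟩
        rot^ d y        ≤⟨ rot^-wrap-≤ y≤N N<y+d (<⇒≤ d<N) ⟩
        d               ≤⟨ d≤c ⟩
        c               ∎)
        where
        open ≤-Reasoning
        N<y+d : N < y + d
        N<y+d = subst (_< y + d) c+d≡N (+-monoˡ-< d c<y)

      no-wrapping : ¬ ∃ (Wrapping d PRel)
      no-wrapping (y , y-wrapping) with y ≤? c
      ... | yes y≤c = not-wrapping-below-c y-wrapping y≤c
      ... | no y≰c = not-wrapping-above-c y-wrapping (≰⇒> y≰c)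

    module LastLabelOutsideBlock (x≁N : ¬ QRel x N) where

      M : ℕ
      M = root x

      x~M : QRel x M
      x~M = lx , root-Label lx , iterate-next-QEq (suc N) x

      ≤M : ∀ {y} → QRel x y → y ≤ M
      ≤M = QRel-≤-root

      M<N : M < N
      M<N = ≤∧≢⇒< (proj₂ (root-Label lx)) λ M≡N → x≁N (subst (QRel x) M≡N x~M)

      opaque
        minimum : ∃ λ m → (Label m × root m ≡ M) × (∀ {y} → Label y × root y ≡ M → m ≤ y)
        minimum = least-witness (λ y → (1 ≤? y ×-dec y ≤? N) ×-dec root y ≟ M) (lx , refl)

      m : ℕ
      m = proj₁ minimum

      lm : Label m
      lm = proj₁ (proj₁ (proj₂ minimum))

      x~m : QRel x m
      x~m = root≡⇒QRel lx lm (sym (proj₂ (proj₁ (proj₂ minimum))))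

      m≤ : ∀ {y} → QRel x y → m ≤ y
      m≤ (_ , ly , x~y) = proj₂ (proj₂ minimum) (ly , sym (QEq⇒root≡ x~y))

      m~ : ∀ {y} → QRel x y → QEq m y
      m~ (_ , _ , x~y) = EqClosure.symmetric QGen (proj₂ (proj₂ x~m)) ◅◅ x~y

      in-B : ∀ {y} → Label y → QEq m y → QRel x y
      in-B ly m~y = lx , ly , (proj₂ (proj₂ x~m) ◅◅ m~y)

      -- A laser separating m from M + 1 would start or end in the block; otherwise it
      -- would trap the block strictly inside it, which QEq-escape rules out.
      m-P-M+1 : PRel m (suc M)
      m-P-M+1 = lm , (s≤s z≤n , M<N) , λ k j ℓ → past-M ℓ , before-m ℓ
        where
        past-M : ∀ {k j} → LaserEnd k j → k < m × m ≤ j → k < suc M × suc M ≤ j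
        past-M {k} {j} ℓ (k<m , m≤j) = <-≤-trans k<m (m≤n⇒m≤1+n (m≤ x~M)) , M<j
          where
          k∉B : ¬ QEq m k
          k∉B m~k = <⇒≱ k<m (m≤ (in-B (proj₁ ℓ) m~k))
          M<j : M < j
          M<j with m≤n⇒m<n∨m≡n m≤j
          ... | inj₂ refl = contradiction (EqClosure.symmetric QGen (laser-QEq ℓ)) k∉B
          ... | inj₁ m<j with QEq-escape ℓ k<m m<j (m~ x~M)
          ...   | inj₁ (_ , M<j) = M<j
          ...   | inj₂ m~j = contradiction (m~j ◅◅ EqClosure.symmetric QGen (laser-QEq ℓ)) k∉B
        before-m : ∀ {k j} → LaserEnd k j → k < suc M × suc M ≤ j → k < m × m ≤ j
        before-m {k} {j} ℓ (k<1+M , M<j) = k<m , ≤-trans (m≤ x~M) (<⇒≤ M<j)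
          where
          j∉B : ¬ QEq M j
          j∉B M~j = <⇒≱ M<j (≤M (in-B (laserEnd-Label ℓ) (m~ x~M ◅◅ M~j)))
          k<m : k < m
          k<m with m≤n⇒m<n∨m≡n (s≤s⁻¹ k<1+M)
          ... | inj₂ refl = contradiction (laser-QEq ℓ) j∉B
          ... | inj₁ k<M with QEq-escape ℓ k<M M<j (EqClosure.symmetric QGen (m~ x~M))
          ...   | inj₁ (k<m , _) = k<m
          ...   | inj₂ M~j = contradiction M~j j∉B

      m-not-central : ¬ Central d PRel m
      m-not-central P-central =
        <-irrefl refl (proj₁ (Respects-inside (<⇒≤ m<c) (B-Respects x~m x~c) (PRel-sym m~c) (m<c , ≤-refl)))
        where
        c : ℕ
        c = rot^ d m
        x~c : QRel x c
        x~c = proj₁ (B-central m lm) x~m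
        m<c : m < c
        m<c = ≤∧≢⇒< (m≤ x~c) (rot^-moves 1≤d d<N lm ∘ sym)
        m~c : PRel m c
        m~c = proj₁ (P-central m lm) (PRel-refl lm)

      P-partner-of-B-within : ∀ {c z} → QRel x c → PRel c z → Σ ℕ λ y₁ → Σ ℕ λ y₂ →
        PRel m y₁ × PRel m y₂ × y₁ ≤ z × z ≤ y₂
      P-partner-of-B-within {c} {z} x~c c~z with m≤n⇒m<n∨m≡n (m≤ x~c)
      ... | inj₂ refl = z , z , c~z , c~z , ≤-refl , ≤-refl
      ... | inj₁ m<c with Respects-inside (<⇒≤ m<c) (B-Respects x~m x~c) c~z (m<c , ≤-refl)
      ...   | m<z , z≤c = m , suc M , PRel-refl lm , m-P-M+1 , <⇒≤ m<z , ≤-trans z≤c (m≤n⇒m≤1+n (≤M x~c))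

      m-wrapping : Wrapping d PRel m
      m-wrapping = lm , m-not-central , λ k y m~y → P-partner-of-B-within (B-rot k x~m) (P-rot k m~y)

    exactly-one : ExactlyOne (QRel x N) (∃ (Wrapping d PRel))
    exactly-one with QRel? lx lN
    ... | yes x~N = inj₁ (x~N , LastLabelInBlock.no-wrapping x~N)
    ... | no x≁N = inj₂ (x≁N , _ , LastLabelOutsideBlock.m-wrapping x≁N)

lemma5p2 : (a b d : ℕ) → 0 < a → 0 < b → Coprime a b →
           1 ≤ d → d < b ∸ 1 → d ∣ (b ∸ 1) →
           (v : Vec ℕ b) → Path.IsDyck a b v → Path.RotInvariant a b v d →
           (x : ℕ) → Path.Label a b v x → Path.Central a b v d (Path.QRel a b v) x →
           ExactlyOne (Path.QRel a b v x (b ∸ 1))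
                      (∃ λ y → Path.Wrapping a b v d (Path.PRel a b v) y)
lemma5p2 a b d _ _ _ 1≤d d<N d∣N v _ (P-invariant , _) x lx B-central =
  Main.exactly-one a b v 1≤d d<N d∣N P-invariant lx B-central
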